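{- Let $M$ be a unicyclic partial multiplication matrix. There is a bound $B$, depending only on $M$, such that for every $M$-coil $\pi$ and every $M$-gridding $\pi^\#$ of $\pi$, the number of misplaced points of $\pi^\#$ is at most $B$.
   Context: A gridding matrix is a matrix with entries in $\{0,1,-1\}$ ($m$ columns, $n$ rows; $M_{ij}$ in column $i$ from the left, row $j$ from the bottom). An $M$-gridding of a permutation is a division of its plot by $m-1$ vertical and $n-1$ horizontal lines into cells, each point interior to a cell, with cell $ij$ empty if $M_{ij}=0$, increasing if $M_{ij}=1$, decreasing if $M_{ij}=-1$. The row-column graph $G_M$ is the bipartite graph on columns and rows with edge $ij'$ iff $M_{ij}\neq0$ (cell $ij$ corresponds to edge $ij'$); $M$ is unicyclic if $G_M$ has exactly one cycle, of length $\ell$ say. A partial multiplication matrix is a gridding matrix with fixed $c_i,r_j\in\{\pm1\}$ such that $M_{ij}=c_ir_j$ whenever $M_{ij}\ne0$; column $i$ is oriented left-to-right if $c_i=1$ and right-to-left otherwise, row $j$ bottom-to-top if $r_j=1$ and top-to-bottom otherwise. The orientation digraph of an $M$-gridded permutation has an arc $x\to y$ between points sharing a column (resp. row) when $x$ precedes $y$ in its orientation. A gridded $M$-coil is an $M$-gridded permutation with $n>\ell$ points, an ordering $v_1,\dots,v_n$ of its points and a labelling $1,\dots,\ell$ of the cells corresponding to the edges of the cycle, with (C1) $v_i$ in cell $i\bmod\ell$ (residues in $\{1,\dots,\ell\}$); (C2) $v_{i-1}\to v_i$ for $1<i\le n$; (C3) $v_i\to v_{i-\ell-1}$ for $\ell+1<i\le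 n$; (C4) $v_{\ell+1}\to v_1$. An $M$-coil is a permutation some $M$-gridding of which is a gridded $M$-coil. In an $M$-gridding of a permutation, a point is misplaced if it lies in a cell that does not correspond to an edge of the cycle of $G_M$. -}

module Defs where

open import Data.Nat using (ℕ; zero; suc; _+_; _*_; NonZero) renaming (_<_ to _<ℕ_)
open import Data.Nat.DivMod using (_%_; m%n<n)
open import Data.Fin using (Fin; toℕ; fromℕ<; _<_; _≤_)
open import Data.Fin.Permutation using (Permutation′; _⟨$⟩ʳ_)
open import Data.Product using (Σ; ∃; _×_; _,_)
open import Data.Sum using (_⊎_)
open import Data.Empty using (⊥)
open import Relation.Binary.PropositionalEquality using (_≡_; _≢_)
open import Function.Definitions using (Injective)
open import Relation.Nullary using (¬_)

data Sign : Set where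
  pos neg : Sign

_·_ : Sign → Sign → Sign
pos · s = s
neg · pos = neg
neg · neg = pos

data Entry : Set where
  zer : Entry
  sgn : Sign → Entry

-- m columns (index 0 = leftmost), n rows (index 0 = bottom); M i j = entry in column i, row j
GriddingMatrix : ℕ → ℕ → Set
GriddingMatrix m n = Fin m → Fin n → Entry

record PMM (m n : ℕ) : Set where
  field
    M : GriddingMatrix m n
    c : Fin m → Sign
    r : Fin n → Sign
    consistent : ∀ i j s → M i j ≡ sgn s → s ≡ c i · r j

Cell : ℕ → ℕ → Set
Cell m n = Fin m × Fin n

next : ∀ {k} .{{_ : NonZero k}} → Fin k → Fin k
next {k} t = fromℕ< (m%n<n (suc (toℕ t)) k)

-- A cycle of the row-column graph G_M:
-- col 0, row 0, col 1, row 1, ..., col (k-1), row (k-1), col 0  with k = 2 + k',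
-- all vertices distinct; its edges are the cells (col t, row t) and (col (t+1 mod k), row t).
record Cycle {m n : ℕ} (M : GriddingMatrix m n) : Set where
  field
    k'      : ℕ
    col     : Fin (2 + k') → Fin m
    row     : Fin (2 + k') → Fin n
    col-inj : Injective _≡_ _≡_ col
    row-inj : Injective _≡_ _≡_ row
    edge₁   : ∀ t → M (col t) (row t) ≢ zer
    edge₂   : ∀ t → M (col (next t)) (row t) ≢ zer

len : ∀ {m n} {M : GriddingMatrix m n} → Cycle M → ℕ
len C = 2 * (2 + Cycle.k' C)

InCycle : ∀ {m n} {M : GriddingMatrix m n} → Cycle M → Cell m n → Set
InCycle C (i , j) = ∃ λ t → (i ≡ col t × j ≡ row t) ⊎ (i ≡ col (next t) × j ≡ row t)
  where open Cycle C

Unicyclic : ∀ {m n} → GriddingMatrix m n → Set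
Unicyclic M = Σ (Cycle M) λ C → ∀ (C' : Cycle M) (e : Cell _ _) →
  (InCycle C e → InCycle C' e) × (InCycle C' e → InCycle C e)

theCycle : ∀ {m n} {M : GriddingMatrix m n} → Unicyclic M → Cycle M
theCycle (C , _) = C

CellShape : ∀ {N} → Entry → Fin N → Fin N → Set
CellShape zer     _ _ = ⊥
CellShape (sgn pos) a b = a < b
CellShape (sgn neg) a b = b < a

-- An M-gridding of the permutation π (points (x , π x)): the vertical lines are
-- encoded by the (weakly increasing) column of each position, the horizontal lines
-- by the (weakly increasing) row of each value.
record Gridding {m n N : ℕ} (M : GriddingMatrix m n) (π : Permutation′ N) : Set where
  field
    gc      : Fin N → Fin m
    gr      : Fin N → Fin n
    gc-mono : ∀ x y → x ≤ y → gc x ≤ gc y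
    gr-mono : ∀ a b → a ≤ b → gr a ≤ gr b
    nonempty-ok : ∀ x → M (gc x) (gr (π ⟨$⟩ʳ x)) ≢ zer
    shape-ok : ∀ x y → x < y → gc x ≡ gc y → gr (π ⟨$⟩ʳ x) ≡ gr (π ⟨$⟩ʳ y) →
               CellShape (M (gc x) (gr (π ⟨$⟩ʳ x))) (π ⟨$⟩ʳ x) (π ⟨$⟩ʳ y)

cellOf : ∀ {m n N} {M : GriddingMatrix m n} {π : Permutation′ N} →
         Gridding M π → Fin N → Cell m n
cellOf {π = π} g x = (Gridding.gc g x , Gridding.gr g (π ⟨$⟩ʳ x))

Prec : ∀ {N} → Sign → Fin N → Fin N → Set
Prec pos a b = a < b
Prec neg a b = b < a

Arc : ∀ {m n N} (P : PMM m n) {π : Permutation′ N} →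
      Gridding (PMM.M P) π → Fin N → Fin N → Set
Arc P {π} g x y =
    (gc x ≡ gc y × Prec (PMM.c P (gc x)) x y)
  ⊎ (gr (π ⟨$⟩ʳ x) ≡ gr (π ⟨$⟩ʳ y) × Prec (PMM.r P (gr (π ⟨$⟩ʳ x))) (π ⟨$⟩ʳ x) (π ⟨$⟩ʳ y))
  where open Gridding g

-- A gridded M-coil (0-indexed: v i = ord ⟨$⟩ʳ i for i = 0..N-1, labels 0..ℓ-1)
record GriddedCoil {m n N : ℕ} (P : PMM m n) (U : Unicyclic (PMM.M P))
                   (π : Permutation′ N) (g : Gridding (PMM.M P) π) : Set where
  field
    ord      : Permutation′ N
    lab      : Fin (len (theCycle U)) → Cell m n
    lab-inj  : Injective _≡_ _≡_ lab
    lab-in   : ∀ t → InCycle (theCycle U) (lab t)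
    lab-onto : ∀ e → InCycle (theCycle U) e → ∃ λ t → lab t ≡ e
    many     : len (theCycle U) <ℕ N
    C1 : ∀ i → cellOf g (ord ⟨$⟩ʳ i) ≡ lab (fromℕ< (m%n<n (toℕ i) (len (theCycle U))))
    C2 : ∀ i j → toℕ j ≡ suc (toℕ i) → Arc P g (ord ⟨$⟩ʳ i) (ord ⟨$⟩ʳ j)
    C3 : ∀ i j → toℕ j ≡ toℕ i + suc (len (theCycle U)) → Arc P g (ord ⟨$⟩ʳ j) (ord ⟨$⟩ʳ i)
    C4 : ∀ i j → toℕ i ≡ 0 → toℕ j ≡ len (theCycle U) → Arc P g (ord ⟨$⟩ʳ j) (ord ⟨$⟩ʳ i)

IsCoil : ∀ {m n N} (P : PMM m n) (U : Unicyclic (PMM.M P)) → Permutation′ N → Set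
IsCoil P U π = Σ (Gridding (PMM.M P) π) λ g → GriddedCoil P U π g

Misplaced : ∀ {m n N} {M : GriddingMatrix m n} {π : Permutation′ N} →
            Unicyclic M → Gridding M π → Fin N → Set
Misplaced U g x = ¬ InCycle (theCycle U) (cellOf g x)

module Submission where

-- Let h be the gridding of the coil, with coil order v₀, v₁, … and cycle length ℓ, and let g
-- be any other gridding.  Consecutive laps of the coil turn inside each other: v_{y+ℓ} and
-- v_y share an h-cell, and v_{y+ℓ} precedes v_y both in the column orientation and in the row
-- orientation of that cell.  So along each residue class mod ℓ the g-column and the g-row of
-- v_y move monotonically, and there are at most ℓ(m+n) events, indices u at which v_u and
-- v_{u+ℓ} lie in different g-cells.  Without an event in a window of ℓ + 1 indices the g-cells
-- of one lap repeat in the next, and the turns of the coil make them a closed non-backtracking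
-- walk of length ℓ in G_M alternating between row and column steps; in a unicyclic graph such
-- a walk runs along the cycle, since a repetition in it would close a shorter cycle.  Hence a
-- misplaced point is among the first ℓ or the last ℓ + 1 points, or at most ℓ steps after an
-- event, and there are at most ℓ + (ℓ + 1) + (ℓ + 1) ℓ (m + n) of them.

open import Data.Bool using (Bool; true; false)
open import Data.Empty using (⊥-elim)
open import Data.Fin using (Fin; zero; suc; toℕ; fromℕ<; join; splitAt)
  renaming (_<_ to _<ᶠ_; _≤_ to _≤ᶠ_)
open import Data.Fin.Permutation using (Permutation′; _⟨$⟩ʳ_; _⟨$⟩ˡ_; inverseʳ)
open import Data.Fin.Properties
  using (toℕ-injective; toℕ<n; toℕ-fromℕ<; injective⇒≤; +↔⊎; *↔×; all?)
import Data.Fin.Properties as Finₚ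
open import Data.Nat
  using (ℕ; zero; suc; _+_; _*_; _∸_; _≤_; _<_; z≤n; s≤s; s≤s⁻¹; z<s; NonZero; >-nonZero; _<?_)
open import Data.Nat.DivMod
open import Data.Nat.Induction using (<-rec)
open import Data.Nat.Properties
open import Data.Nat.Tactic.RingSolver using (solve-∀)
open import Data.Product using (∃; _×_; _,_; proj₁; proj₂; map; map₂)
open import Data.Product.Function.NonDependent.Propositional using (_×-↔_)
open import Data.Product.Properties using (≡-dec)
open import Data.Sum using (_⊎_; inj₁; inj₂; [_,_]′)
open import Data.Sum.Function.Propositional using (_⊎-↔_)
open import Function using (_∘_; const; id)
open import Function.Bundles using (Injection; Inverse; _↔_)
open import Function.Definitions using (Injective)
open import Function.Properties.Inverse using (↔⇒↣; ↔-refl; ↔-sym; ↔-trans)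
open import Relation.Binary.Core using (Rel)
import Relation.Binary.Construct.Flip.EqAndOrd as Flip
open import Relation.Binary.Definitions using (tri<; tri≈; tri>)
open import Relation.Binary.PropositionalEquality
open import Relation.Binary.Structures using (IsPartialOrder)
open import Relation.Nullary using (¬_; yes; no; contradiction)
open import Relation.Unary using (Decidable)

open import Defs

Distinct : {A : Set} → (ℕ → A) → ℕ → Set
Distinct f D = ∀ {i j} → i < j → j < D → f i ≢ f j

Distinct⇒injective : ∀ {A : Set} {D} (f : ℕ → A) → Distinct f D →
                     Injective _≡_ _≡_ (λ (i : Fin D) → f (toℕ i))
Distinct⇒injective f distinct {i} {j} eq with <-cmp (toℕ i) (toℕ j)
... | tri< i<j _ _ = contradiction eq (distinct i<j (toℕ<n j))
... | tri≈ _ i≡j _ = toℕ-injective i≡j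
... | tri> _ _ j<i = contradiction (sym eq) (distinct j<i (toℕ<n i))

⊎-injective⇒≤ : ∀ {a b c d} {f : Fin a ⊎ Fin b → Fin c ⊎ Fin d} →
                Injective _≡_ _≡_ f → a + b ≤ c + d
⊎-injective⇒≤ {a} {b} {c} {d} {f} f-inj =
  injective⇒≤ {f = join c d ∘ f ∘ splitAt a} λ eq → splitAt-injective (f-inj (join-injective eq))
  where
  splitAt-injective : Injective _≡_ _≡_ (splitAt a {b})
  splitAt-injective = Injection.injective (↔⇒↣ +↔⊎)
  join-injective : Injective _≡_ _≡_ (join c d)
  join-injective = Injection.injective (↔⇒↣ (↔-sym +↔⊎))

m+m≤n+n⇒m≤n : ∀ {m n} → m + m ≤ n + n → m ≤ n
m+m≤n+n⇒m≤n {m} {n} m+m≤n+n = ≮⇒≥ λ n<m → <⇒≱ (+-mono-< n<m n<m) m+m≤n+n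

Bool-pigeonhole : (a b c : Bool) → a ≡ b ⊎ b ≡ c ⊎ a ≡ c
Bool-pigeonhole true  true  _     = inj₁ refl
Bool-pigeonhole false false _     = inj₁ refl
Bool-pigeonhole true  false true  = inj₂ (inj₂ refl)
Bool-pigeonhole true  false false = inj₂ (inj₁ refl)
Bool-pigeonhole false true  true  = inj₂ (inj₁ refl)
Bool-pigeonhole false true  false = inj₂ (inj₂ refl)

even-or-odd : ∀ u → ∃ λ t → u ≡ t + t ⊎ u ≡ suc (t + t)
even-or-odd zero = 0 , inj₁ refl
even-or-odd (suc u) with even-or-odd u
... | t , inj₁ refl = t , inj₂ refl
... | t , inj₂ refl = suc t , inj₁ (cong suc (sym (+-suc t t)))

module _ {n : ℕ} .{{_ : NonZero n}} where

  %-cong-+ʳ : ∀ {m m′} k → m % n ≡ m′ % n → (m + k) % n ≡ (m′ + k) % n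
  %-cong-+ʳ {m} {m′} k eq = begin
    (m + k) % n              ≡⟨ %-distribˡ-+ m k n ⟩
    (m % n + k % n) % n      ≡⟨ cong (λ x → (x + k % n) % n) eq ⟩
    (m′ % n + k % n) % n     ≡⟨ %-distribˡ-+ m′ k n ⟨
    (m′ + k) % n             ∎
    where open ≡-Reasoning

  [1+m%n]%n≡[1+m]%n : ∀ m → suc (m % n) % n ≡ suc m % n
  [1+m%n]%n≡[1+m]%n m = begin
    (1 + m % n) % n          ≡⟨ %-distribˡ-+ 1 (m % n) n ⟩
    (1 % n + m % n % n) % n  ≡⟨ cong (λ x → (1 % n + x) % n) (m%n%n≡m%n m n) ⟩
    (1 % n + m % n) % n      ≡⟨ %-distribˡ-+ 1 m n ⟨
    (1 + m) % n              ∎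
    where open ≡-Reasoning

  [d+r]%n≢r : ∀ {d r} → 0 < d → d < n → r < n → (d + r) % n ≢ r
  [d+r]%n≢r {d} {r} 0<d d<n r<n eq with d + r <? n
  ... | yes fits  = <-irrefl (trans (sym eq) (m<n⇒m%n≡m fits)) (m<n+m r 0<d)
  ... | no  wraps = <-irrefl (+-cancelʳ-≡ r d n (begin
      d + r            ≡⟨ m∸n+n≡m n≤d+r ⟨
      (d + r ∸ n) + n  ≡⟨ cong (_+ n) wrapped≡r ⟩
      r + n            ≡⟨ +-comm r n ⟩
      n + r            ∎)) d<n
    where
    open ≡-Reasoning
    n≤d+r : n ≤ d + r
    n≤d+r = ≮⇒≥ wraps
    wrapped<n : d + r ∸ n < n
    wrapped<n = subst (d + r ∸ n <_) (m+n∸n≡m n n) (∸-monoˡ-< (+-mono-< d<n r<n) n≤d+r)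
    wrapped≡r : d + r ∸ n ≡ r
    wrapped≡r = trans (sym (m<n⇒m%n≡m wrapped<n)) (trans (m≤n⇒[n∸m]%m≡n%m n≤d+r) eq)

  [d+m]%n≢m%n : ∀ m {d} → 0 < d → d < n → (d + m) % n ≢ m % n
  [d+m]%n≢m%n m {d} 0<d d<n eq = [d+r]%n≢r 0<d d<n (m%n<n m n) (begin
    (d + m % n) % n      ≡⟨ cong (λ x → (x + m % n) % n) (m<n⇒m%n≡m d<n) ⟨
    (d % n + m % n) % n  ≡⟨ %-distribˡ-+ d m n ⟨
    (d + m) % n          ≡⟨ eq ⟩
    m % n                ∎)
    where open ≡-Reasoning

module _ {a ℓ} {A : Set a} {_≼_ : Rel A ℓ} (≼-isPartialOrder : IsPartialOrder _≡_ _≼_)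
         (ψ : ℕ → A) (Ok : ℕ → Set) (Ok-down : ∀ {p q} → p ≤ q → Ok q → Ok p)
         (descending : ∀ q → Ok q → ψ (suc q) ≼ ψ q) where
  open IsPartialOrder ≼-isPartialOrder using ()
    renaming (refl to ≼-refl; trans to ≼-trans; antisym to ≼-antisym)

  descending-chain : ∀ k {i} → Ok (k + i) → ψ (k + i) ≼ ψ i
  descending-chain zero    _  = ≼-refl
  descending-chain (suc k) ok =
    ≼-trans (descending _ (Ok-down (n≤1+n _) ok)) (descending-chain k (Ok-down (n≤1+n _) ok))

  later-descent-lands-lower : ∀ {q q′} → q < q′ → Ok q′ →
                              ψ (suc q′) ≢ ψ q′ → ψ (suc q) ≢ ψ (suc q′)
  later-descent-lands-lower {q} {q′} q<q′ ok strict same =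
    strict (≼-antisym (descending q′ ok) (subst (ψ q′ ≼_) same reaches))
    where
    reaches : ψ q′ ≼ ψ (suc q)
    reaches = subst (λ i → ψ i ≼ ψ (suc q)) (m∸n+n≡m q<q′)
      (descending-chain (q′ ∸ suc q) (subst Ok (sym (m∸n+n≡m q<q′)) ok))

  strict-descents-injective : ∀ {q₁ q₂} → Ok q₁ → Ok q₂ → ψ (suc q₁) ≢ ψ q₁ → ψ (suc q₂) ≢ ψ q₂ →
                              ψ (suc q₁) ≡ ψ (suc q₂) → q₁ ≡ q₂
  strict-descents-injective {q₁} {q₂} ok₁ ok₂ strict₁ strict₂ same with <-cmp q₁ q₂
  ... | tri< q₁<q₂ _ _ = contradiction same (later-descent-lands-lower q₁<q₂ ok₂ strict₂)
  ... | tri≈ _ q₁≡q₂ _ = q₁≡q₂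
  ... | tri> _ _ q₂<q₁ = contradiction (sym same) (later-descent-lands-lower q₂<q₁ ok₁ strict₁)

-- Cycles and closed walks in the row-column graph

toℕ-next : ∀ {d} (t : Fin (2 + d)) →
  toℕ (next t) ≡ suc (toℕ t) ⊎ (toℕ (next t) ≡ 0 × toℕ t ≡ suc d)
toℕ-next {d} t with suc (toℕ t) <? 2 + d
... | yes t+1<k = inj₁ (trans (toℕ-fromℕ< _) (m<n⇒m%n≡m t+1<k))
... | no  t+1≮k = inj₂ (trans (toℕ-fromℕ< _) (trans (cong (_% (2 + d)) t+1≡k) (n%n≡0 (2 + d))) ,
                      suc-injective t+1≡k)
  where
  t+1≡k : suc (toℕ t) ≡ 2 + d
  t+1≡k = ≤-antisym (toℕ<n t) (≮⇒≥ t+1≮k)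

next-injective : ∀ {d} → Injective _≡_ _≡_ (next {2 + d})
next-injective {d} {s} {t} eq with toℕ-next s | toℕ-next t
... | inj₁ s′ | inj₁ t′ = toℕ-injective (suc-injective (trans (sym s′) (trans (cong toℕ eq) t′)))
... | inj₁ s′ | inj₂ (t′ , _) = contradiction (trans (sym s′) (trans (cong toℕ eq) t′)) λ ()
... | inj₂ (s′ , _) | inj₁ t′ = contradiction (trans (sym t′) (trans (cong toℕ (sym eq)) s′)) λ ()
... | inj₂ (_ , s′) | inj₂ (_ , t′) = toℕ-injective (trans s′ (sym t′))

next-≢ : ∀ {d} (t : Fin (2 + d)) → next t ≢ t
next-≢ t eq with toℕ-next t
... | inj₁ t′ = <-irrefl (trans (sym (cong toℕ eq)) t′) (n<1+n _)
... | inj₂ (t′ , t″) = contradiction (trans (sym t″) (trans (sym (cong toℕ eq)) t′)) λ ()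

SameColumn SameRow : ∀ {m n} → Cell m n → Cell m n → Set
SameColumn e e′ = proj₁ e ≡ proj₁ e′
SameRow    e e′ = proj₂ e ≡ proj₂ e′

Nonzero : ∀ {m n} → GriddingMatrix m n → Cell m n → Set
Nonzero M (i , j) = M i j ≢ zer

module _ {m n} {M : GriddingMatrix m n} (C : Cycle M) where
  open Cycle C

  cycleCell : Fin (2 + k') ⊎ Fin (2 + k') → Cell m n
  cycleCell (inj₁ t) = col t , row t
  cycleCell (inj₂ t) = col (next t) , row t

  cycleCell-injective : Injective _≡_ _≡_ cycleCell
  cycleCell-injective {inj₁ s} {inj₁ t} eq = cong inj₁ (row-inj (cong proj₂ eq))
  cycleCell-injective {inj₂ s} {inj₂ t} eq = cong inj₂ (row-inj (cong proj₂ eq))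
  cycleCell-injective {inj₁ s} {inj₂ t} eq with refl ← row-inj (cong proj₂ eq) =
    contradiction (col-inj (sym (cong proj₁ eq))) (next-≢ s)
  cycleCell-injective {inj₂ s} {inj₁ t} eq with refl ← row-inj (cong proj₂ eq) =
    contradiction (col-inj (cong proj₁ eq)) (next-≢ s)

  cycleIndex : ∀ {e} → InCycle C e → Fin (2 + k') ⊎ Fin (2 + k')
  cycleIndex (t , inj₁ _) = inj₁ t
  cycleIndex (t , inj₂ _) = inj₂ t

  cycleCell-cycleIndex : ∀ {e} (p : InCycle C e) → cycleCell (cycleIndex p) ≡ e
  cycleCell-cycleIndex (t , inj₁ (refl , refl)) = refl
  cycleCell-cycleIndex (t , inj₂ (refl , refl)) = refl

  cycleCell-InCycle : ∀ x → InCycle C (cycleCell x)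
  cycleCell-InCycle (inj₁ t) = t , inj₁ (refl , refl)
  cycleCell-InCycle (inj₂ t) = t , inj₂ (refl , refl)

  side : Fin (2 + k') ⊎ Fin (2 + k') → Bool
  side = [ const true , const false ]′

  column-determines-cell : ∀ x y → side x ≡ side y → SameColumn (cycleCell x) (cycleCell y) → x ≡ y
  column-determines-cell (inj₁ s) (inj₁ t) _ eq = cong inj₁ (col-inj eq)
  column-determines-cell (inj₂ s) (inj₂ t) _ eq = cong inj₂ (next-injective (col-inj eq))

  row-determines-cell : ∀ x y → side x ≡ side y → SameRow (cycleCell x) (cycleCell y) → x ≡ y
  row-determines-cell (inj₁ s) (inj₁ t) _ eq = cong inj₁ (row-inj eq)
  row-determines-cell (inj₂ s) (inj₂ t) _ eq = cong inj₂ (row-inj eq)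

  module _ {L : Set} (line : Cell m n → L)
           (line-determines-cell : ∀ x y → side x ≡ side y →
                                   line (cycleCell x) ≡ line (cycleCell y) → x ≡ y) where

    same-side-and-line⇒≡ : ∀ {e e′} (p : InCycle C e) (p′ : InCycle C e′) →
      side (cycleIndex p) ≡ side (cycleIndex p′) → line e ≡ line e′ → e ≡ e′
    same-side-and-line⇒≡ p p′ s eq = subst₂ _≡_ (cycleCell-cycleIndex p) (cycleCell-cycleIndex p′)
      (cong cycleCell (line-determines-cell _ _ s
        (subst₂ (λ a b → line a ≡ line b)
          (sym (cycleCell-cycleIndex p)) (sym (cycleCell-cycleIndex p′)) eq)))

    at-most-two-on-a-line : ∀ {e₁ e₂ e₃} → InCycle C e₁ → InCycle C e₂ → InCycle C e₃ →
      line e₁ ≡ line e₂ → line e₂ ≡ line e₃ → e₁ ≡ e₂ ⊎ e₂ ≡ e₃ ⊎ e₁ ≡ e₃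
    at-most-two-on-a-line p₁ p₂ p₃ l₁₂ l₂₃
      with Bool-pigeonhole (side (cycleIndex p₁)) (side (cycleIndex p₂)) (side (cycleIndex p₃))
    ... | inj₁ s₁₂        = inj₁ (same-side-and-line⇒≡ p₁ p₂ s₁₂ l₁₂)
    ... | inj₂ (inj₁ s₂₃) = inj₂ (inj₁ (same-side-and-line⇒≡ p₂ p₃ s₂₃ l₂₃))
    ... | inj₂ (inj₂ s₁₃) = inj₂ (inj₂ (same-side-and-line⇒≡ p₁ p₃ s₁₃ (trans l₁₂ l₂₃)))

  at-most-two-in-a-column : ∀ {e₁ e₂ e₃} → InCycle C e₁ → InCycle C e₂ → InCycle C e₃ →
    SameColumn e₁ e₂ → SameColumn e₂ e₃ → e₁ ≡ e₂ ⊎ e₂ ≡ e₃ ⊎ e₁ ≡ e₃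
  at-most-two-in-a-column = at-most-two-on-a-line proj₁ column-determines-cell

  at-most-two-in-a-row : ∀ {e₁ e₂ e₃} → InCycle C e₁ → InCycle C e₂ → InCycle C e₃ →
    SameRow e₁ e₂ → SameRow e₂ e₃ → e₁ ≡ e₂ ⊎ e₂ ≡ e₃ ⊎ e₁ ≡ e₃
  at-most-two-in-a-row = at-most-two-on-a-line proj₂ row-determines-cell

module _ {m n} {M : GriddingMatrix m n} (U : Unicyclic M) where

  InCycle-theCycle : ∀ (C′ : Cycle M) {e} → InCycle C′ e → InCycle (theCycle U) e
  InCycle-theCycle C′ {e} = proj₂ (proj₂ U C′ e)

  k′-minimal : (C′ : Cycle M) → Cycle.k' (theCycle U) ≤ Cycle.k' C′
  k′-minimal C′ =
    s≤s⁻¹ (s≤s⁻¹ (m+m≤n+n⇒m≤n (⊎-injective⇒≤ {f = transfer} transfer-injective)))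
    where
    C : Cycle M
    C = theCycle U
    transfer : Fin (2 + Cycle.k' C) ⊎ Fin (2 + Cycle.k' C) → Fin (2 + Cycle.k' C′) ⊎ Fin (2 + Cycle.k' C′)
    transfer x = cycleIndex C′ (proj₁ (proj₂ U C′ (cycleCell C x)) (cycleCell-InCycle C x))
    transfer-injective : Injective _≡_ _≡_ transfer
    transfer-injective {x} {y} eq = cycleCell-injective C (subst₂ _≡_
      (cycleCell-cycleIndex C′ _) (cycleCell-cycleIndex C′ _) (cong (cycleCell C′) eq))

module ClosedWalk {m n} {M : GriddingMatrix m n} (U : Unicyclic M)
  (cw : ℕ → Fin m) (rw : ℕ → Fin n)
  (nz₁ : ∀ t → Nonzero M (cw t , rw t))
  (nz₂ : ∀ t → Nonzero M (cw (suc t) , rw t))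
  (cw-step : ∀ t → cw t ≢ cw (suc t))
  (rw-step : ∀ t → rw t ≢ rw (suc t))
  (cw-periodic : ∀ t → cw (2 + Cycle.k' (theCycle U) + t) ≡ cw t) where

  private
    k : ℕ
    k = Cycle.k' (theCycle U)

  stretch-cycle : ∀ b d → Distinct (λ i → cw (i + b)) (2 + d) → Distinct (λ i → rw (i + b)) (2 + d) →
           Nonzero M (cw b , rw (suc d + b)) → Cycle M
  stretch-cycle b d cw-distinct rw-distinct closing = record
    { k'      = d
    ; col     = λ i → cw (toℕ i + b)
    ; row     = λ i → rw (toℕ i + b)
    ; col-inj = Distinct⇒injective (λ i → cw (i + b)) cw-distinct
    ; row-inj = Distinct⇒injective (λ i → rw (i + b)) rw-distinct
    ; edge₁   = λ t → nz₁ (toℕ t + b)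
    ; edge₂   = edge₂
    }
    where
    edge₂ : ∀ t → Nonzero M (cw (toℕ (next t) + b) , rw (toℕ t + b))
    edge₂ t with toℕ-next t
    ... | inj₁ t+1 rewrite t+1 = nz₂ (toℕ t + b)
    ... | inj₂ (wraps , last) rewrite wraps | last = closing

  NoRepeat : ℕ → Set
  NoRepeat d = ∀ a → cw a ≢ cw (d + a) × rw a ≢ rw (d + a)

  distinct-stretch : ∀ {D} → (∀ e → 0 < e → e < D → NoRepeat e) → ∀ b →
    Distinct (λ i → cw (i + b)) D × Distinct (λ i → rw (i + b)) D
  distinct-stretch {D} no-repeat b =
    (λ i<j j<D → proj₁ (apart i<j j<D)) , (λ i<j j<D → proj₂ (apart i<j j<D))
    where
    apart : ∀ {i j} → i < j → j < D → cw (i + b) ≢ cw (j + b) × rw (i + b) ≢ rw (j + b)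
    apart {i} {j} i<j j<D rewrite sym (cong (_+ b) (m∸n+n≡m (<⇒≤ i<j))) | +-assoc (j ∸ i) i b =
      no-repeat (j ∸ i) (m<n⇒0<n∸m i<j) (≤-<-trans (m∸n≤m j i) j<D) (i + b)

  -- A repetition at distance d < 2 + k would close a cycle with 2 d < len (theCycle U) edges.
  no-repeat : ∀ d → 0 < d → d < 2 + k → NoRepeat d
  no-repeat = <-rec (λ d → 0 < d → d < 2 + k → NoRepeat d) go
    where
    go : ∀ d → (∀ {e} → e < d → 0 < e → e < 2 + k → NoRepeat e) → 0 < d → d < 2 + k → NoRepeat d
    go 1             _   _ _   a = cw-step a , rw-step a
    go (suc (suc d)) rec _ d<K a = cw-apart , rw-apart
      where
      stretch : ∀ b → Distinct (λ i → cw (i + b)) (2 + d) × Distinct (λ i → rw (i + b)) (2 + d)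
      stretch = distinct-stretch (λ e 0<e e<d → rec e<d 0<e (<-trans e<d d<K))
      cw-apart : cw a ≢ cw (2 + d + a)
      cw-apart eq = <⇒≱ (s≤s⁻¹ (s≤s⁻¹ d<K))
        (k′-minimal U (stretch-cycle a d (proj₁ (stretch a)) (proj₂ (stretch a)) closing))
        where
        closing : Nonzero M (cw a , rw (suc d + a))
        closing = subst (λ i → Nonzero M (i , rw (suc d + a))) (sym eq) (nz₂ (suc d + a))
      rw-apart : rw a ≢ rw (2 + d + a)
      rw-apart eq = <⇒≱ (s≤s⁻¹ (s≤s⁻¹ d<K))
        (k′-minimal U (stretch-cycle (suc a) d (proj₁ (stretch (suc a))) (proj₂ (stretch (suc a))) closing))
        where
        closing : Nonzero M (cw (suc a) , rw (suc d + suc a))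
        closing = subst (λ j → Nonzero M (cw (suc a) , j))
                        (trans eq (sym (cong rw (+-suc (suc d) a)))) (nz₂ a)

  walk-in-cycle : ∀ t →
    InCycle (theCycle U) (cw t , rw t) × InCycle (theCycle U) (cw (suc t) , rw t)
  walk-in-cycle t =
    InCycle-theCycle U W (zero , inj₁ (refl , refl)) , InCycle-theCycle U W (zero , inj₂ (refl , refl))
    where
    stretch : Distinct (λ i → cw (i + t)) (2 + k) × Distinct (λ i → rw (i + t)) (2 + k)
    stretch = distinct-stretch no-repeat t
    closing : Nonzero M (cw t , rw (suc k + t))
    closing = subst (λ i → Nonzero M (i , rw (suc k + t))) (cw-periodic t) (nz₂ (suc k + t))
    W : Cycle M
    W = stretch-cycle t k (proj₁ stretch) (proj₂ stretch) closing

module CellWalk {m n} {M : GriddingMatrix m n} (U : Unicyclic M) (F : ℕ → Cell m n)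
  (F-periodic : ∀ u → F (len (theCycle U) + u) ≡ F u)
  (F-nonzero : ∀ u → Nonzero M (F u))
  (F-step : ∀ u → F u ≢ F (suc u))
  (row-then-column : ∀ u → SameRow (F u) (F (suc u)) → SameColumn (F (suc u)) (F (2 + u)))
  (column-then-row : ∀ u → SameColumn (F u) (F (suc u)) → SameRow (F (suc u)) (F (2 + u)))
  (starts-along-row : SameRow (F 0) (F 1)) where

  private
    k : ℕ
    k = Cycle.k' (theCycle U)

  -- F (2t) = (cw t , rw t) and F (2t+1) = (cw (t+1) , rw t) are the edges of the walk
  -- cw 0, rw 0, cw 1, rw 1, … in the row-column graph.
  even-step : ∀ t → SameRow (F (t + t)) (F (suc (t + t)))
  odd-step : ∀ t → SameColumn (F (suc (t + t))) (F (2 + (t + t)))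
  even-step zero = starts-along-row
  even-step (suc t) rewrite +-suc t t = column-then-row (suc (t + t)) (odd-step t)
  odd-step t = row-then-column (t + t) (even-step t)

  cw : ℕ → Fin m
  cw t = proj₁ (F (t + t))

  rw : ℕ → Fin n
  rw t = proj₂ (F (t + t))

  odd-cell : ∀ t → F (suc (t + t)) ≡ (cw (suc t) , rw t)
  odd-cell t =
    cong₂ _,_ (trans (odd-step t) (cong (proj₁ ∘ F ∘ suc) (sym (+-suc t t)))) (sym (even-step t))

  cw-periodic : ∀ t → cw (2 + k + t) ≡ cw t
  cw-periodic t = cong proj₁ (trans (cong F (twice (2 + k) t)) (F-periodic (t + t)))
    where
    twice : ∀ a b → (a + b) + (a + b) ≡ 2 * a + (b + b)
    twice = solve-∀

  open ClosedWalk U cw rw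
    (λ t → F-nonzero (t + t))
    (λ t → subst (Nonzero M) (odd-cell t) (F-nonzero (suc (t + t))))
    (λ t eq → F-step (t + t) (trans (cong₂ _,_ eq refl) (sym (odd-cell t))))
    (λ t eq → F-step (suc (t + t))
      (cong₂ _,_ (odd-step t) (trans (sym (even-step t)) (trans eq (cong (proj₂ ∘ F) (+-suc (suc t) t))))))
    cw-periodic

  cells-in-cycle : ∀ u → InCycle (theCycle U) (F u)
  cells-in-cycle u with even-or-odd u
  ... | t , inj₁ refl = proj₁ (walk-in-cycle t)
  ... | t , inj₂ refl = subst (InCycle (theCycle U)) (sym (odd-cell t)) (proj₂ (walk-in-cycle t))

-- Orientations in a gridding

module _ {N : ℕ} where

  Prec-trans : ∀ σ {x y z : Fin N} → Prec σ x y → Prec σ y z → Prec σ x z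
  Prec-trans pos x<y y<z = <-trans x<y y<z
  Prec-trans neg y<x z<y = <-trans z<y y<x

  Prec-asym : ∀ σ {x y : Fin N} → Prec σ x y → ¬ Prec σ y x
  Prec-asym pos = <-asym
  Prec-asym neg = <-asym

  Prec-irrefl : ∀ σ {x : Fin N} → ¬ Prec σ x x
  Prec-irrefl σ x<x = Prec-asym σ x<x x<x

  Prec-trichotomy : ∀ σ (x y : Fin N) → Prec σ x y ⊎ x ≡ y ⊎ Prec σ y x
  Prec-trichotomy pos x y with Finₚ.<-cmp x y
  ... | tri< x<y _ _ = inj₁ x<y
  ... | tri≈ _ x≡y _ = inj₂ (inj₁ x≡y)
  ... | tri> _ _ y<x = inj₂ (inj₂ y<x)
  Prec-trichotomy neg x y with Finₚ.<-cmp x y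
  ... | tri< x<y _ _ = inj₂ (inj₂ x<y)
  ... | tri≈ _ x≡y _ = inj₂ (inj₁ x≡y)
  ... | tri> _ _ y<x = inj₁ y<x

  Between : Fin N → Fin N → Fin N → Set
  Between x y z = (x <ᶠ y × y <ᶠ z) ⊎ (z <ᶠ y × y <ᶠ x)

  Between-sym : ∀ {x y z} → Between x y z → Between z y x
  Between-sym (inj₁ xyz) = inj₂ xyz
  Between-sym (inj₂ zyx) = inj₁ zyx

  Prec⇒Between : ∀ σ {x y z} → Prec σ x y → Prec σ y z → Between x y z
  Prec⇒Between pos x<y y<z = inj₁ (x<y , y<z)
  Prec⇒Between neg y<x z<y = inj₂ (z<y , y<x)

  Between⇒Prec : ∀ σ {x y z} → Between x y z → (Prec σ x y × Prec σ y z) ⊎ (Prec σ z y × Prec σ y x)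
  Between⇒Prec pos (inj₁ (x<y , y<z)) = inj₁ (x<y , y<z)
  Between⇒Prec pos (inj₂ (z<y , y<x)) = inj₂ (z<y , y<x)
  Between⇒Prec neg (inj₁ (x<y , y<z)) = inj₂ (y<z , x<y)
  Between⇒Prec neg (inj₂ (z<y , y<x)) = inj₁ (y<x , z<y)

  monotone-Between : ∀ {k} (f : Fin N → Fin k) → (∀ x y → x ≤ᶠ y → f x ≤ᶠ f y) →
                     ∀ {x y z} → Between x y z → f x ≡ f z → f y ≡ f x
  monotone-Between f mono {x} {y} {z} (inj₁ (x<y , y<z)) fx≡fz =
    Finₚ.≤-antisym (subst (f y ≤ᶠ_) (sym fx≡fz) (mono y z (<⇒≤ y<z))) (mono x y (<⇒≤ x<y))
  monotone-Between f mono {x} {y} {z} (inj₂ (z<y , y<x)) fx≡fz =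
    Finₚ.≤-antisym (mono y x (<⇒≤ y<x)) (subst (_≤ᶠ f y) (sym fx≡fz) (mono z y (<⇒≤ z<y)))

Prec-reflect : ∀ {N N′} γ ρ {x y : Fin N} {a b : Fin N′} →
               (x ≡ y → a ≡ b) → (Prec γ y x → Prec ρ b a) → Prec ρ a b → Prec γ x y
Prec-reflect γ ρ {x} {y} same flipped a≺b with Prec-trichotomy γ x y
... | inj₁ x≺y        = x≺y
... | inj₂ (inj₁ x≡y) = contradiction (subst (λ b → Prec ρ _ b) (sym (same x≡y)) a≺b) (Prec-irrefl ρ)
... | inj₂ (inj₂ y≺x) = contradiction (flipped y≺x) (Prec-asym ρ a≺b)

Prec-· : ∀ {N N′} γ ρ {x y : Fin N} {a b : Fin N′} →
         (x <ᶠ y → Prec (γ · ρ) a b) → (y <ᶠ x → Prec (γ · ρ) b a) → Prec γ x y → Prec ρ a b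
Prec-· pos ρ   forward _        x<y = forward x<y
Prec-· neg pos _       backward y<x = backward y<x
Prec-· neg neg _       backward y<x = backward y<x

CellShape⇒Prec : ∀ {N} σ {a b : Fin N} → CellShape (sgn σ) a b → Prec σ a b
CellShape⇒Prec pos a<b = a<b
CellShape⇒Prec neg b<a = b<a

WeakPrec : ∀ {k} → Sign → Fin k → Fin k → Set
WeakPrec pos a b = a ≤ᶠ b
WeakPrec neg a b = b ≤ᶠ a

WeakPrec-isPartialOrder : ∀ {k} σ → IsPartialOrder _≡_ (WeakPrec {k} σ)
WeakPrec-isPartialOrder pos = Finₚ.≤-isPartialOrder
WeakPrec-isPartialOrder neg = Flip.isPartialOrder Finₚ.≤-isPartialOrder

Prec⇒WeakPrec : ∀ {N k} σ (f : Fin N → Fin k) → (∀ x y → x ≤ᶠ y → f x ≤ᶠ f y) →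
                ∀ {x y} → Prec σ x y → WeakPrec σ (f x) (f y)
Prec⇒WeakPrec pos f mono {x} {y} x<y = mono x y (<⇒≤ x<y)
Prec⇒WeakPrec neg f mono {x} {y} y<x = mono y x (<⇒≤ y<x)

module Oriented {m n} (P : PMM m n) {N} {π : Permutation′ N} (g : Gridding (PMM.M P) π) where
  open PMM P
  open Gridding g

  val : Fin N → Fin N
  val x = π ⟨$⟩ʳ x

  rowOf : Fin N → Fin n
  rowOf x = gr (val x)

  cell : Fin N → Cell m n
  cell = cellOf g

  sign : Cell m n → Sign
  sign (i , j) = c i · r j

  cell-sign : ∀ x → M (gc x) (rowOf x) ≡ sgn (sign (cell x))
  cell-sign x with M (gc x) (rowOf x) | nonempty-ok x | consistent (gc x) (rowOf x)
  ... | zer   | nonzero | _          = ⊥-elim (nonzero refl)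
  ... | sgn s | _       | consistent = cong sgn (consistent s refl)

  in-cell : ∀ {e x y} → cell x ≡ e → cell y ≡ e → x <ᶠ y → Prec (sign e) (val x) (val y)
  in-cell {e} {x} {y} refl y∈e x<y = CellShape⇒Prec (sign e)
    (subst (λ s → CellShape s (val x) (val y)) (cell-sign x)
      (shape-ok x y x<y (cong proj₁ (sym y∈e)) (cong proj₂ (sym y∈e))))

  oriented : ∀ {e x y} → cell x ≡ e → cell y ≡ e →
             Prec (c (proj₁ e)) x y → Prec (r (proj₂ e)) (val x) (val y)
  oriented {e} x∈e y∈e = Prec-· (c (proj₁ e)) (r (proj₂ e)) (in-cell x∈e y∈e) (in-cell y∈e x∈e)

  oriented⁻¹ : ∀ {e x y} → cell x ≡ e → cell y ≡ e →
               Prec (r (proj₂ e)) (val x) (val y) → Prec (c (proj₁ e)) x y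
  oriented⁻¹ {e} x∈e y∈e = Prec-reflect (c (proj₁ e)) (r (proj₂ e)) (cong val) (oriented y∈e x∈e)

  Between-in-cell : ∀ {e x y z} → cell x ≡ e → cell y ≡ e → cell z ≡ e →
                    Between x y z → Between (val x) (val y) (val z)
  Between-in-cell {e} x∈e y∈e z∈e xyz with Between⇒Prec (c (proj₁ e)) xyz
  ... | inj₁ (x≺y , y≺z) =
    Prec⇒Between (r (proj₂ e)) (oriented x∈e y∈e x≺y) (oriented y∈e z∈e y≺z)
  ... | inj₂ (z≺y , y≺x) =
    Between-sym (Prec⇒Between (r (proj₂ e)) (oriented z∈e y∈e z≺y) (oriented y∈e x∈e y≺x))

  Between-in-cell⁻¹ : ∀ {e x y z} → cell x ≡ e → cell y ≡ e → cell z ≡ e →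
                      Between (val x) (val y) (val z) → Between x y z
  Between-in-cell⁻¹ {e} x∈e y∈e z∈e xyz with Between⇒Prec (r (proj₂ e)) xyz
  ... | inj₁ (x≺y , y≺z) =
    Prec⇒Between (c (proj₁ e)) (oriented⁻¹ x∈e y∈e x≺y) (oriented⁻¹ y∈e z∈e y≺z)
  ... | inj₂ (z≺y , y≺x) =
    Between-sym (Prec⇒Between (c (proj₁ e)) (oriented⁻¹ z∈e y∈e z≺y) (oriented⁻¹ y∈e x∈e y≺x))

  data Turn (p q p′ : Fin N) : Set where
    column-turn : gc q ≡ gc p → Prec (c (gc p)) p q → Prec (c (gc p)) q p′ → Turn p q p′
    row-turn    : rowOf q ≡ rowOf p → Prec (r (rowOf p)) (val p) (val q) →
                  Prec (r (rowOf p)) (val q) (val p′) → Turn p q p′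

  turn : ∀ {p q p′} → cell p′ ≡ cell p → cell q ≢ cell p →
         Arc P g p q → Arc P g q p′ → Turn p q p′
  turn {p} {q} {p′} _ _ (inj₁ (p∣q , p≺q)) (inj₁ (_ , q≺p′)) =
    column-turn (sym p∣q) p≺q (subst (λ i → Prec (c i) q p′) (sym p∣q) q≺p′)
  turn {p} {q} {p′} _ _ (inj₂ (p─q , p≺q)) (inj₂ (_ , q≺p′)) =
    row-turn (sym p─q) p≺q (subst (λ j → Prec (r j) (val q) (val p′)) (sym p─q) q≺p′)
  turn same new (inj₁ (p∣q , _)) (inj₂ (q─p′ , _)) =
    ⊥-elim (new (cong₂ _,_ (sym p∣q) (trans q─p′ (cong proj₂ same))))
  turn same new (inj₂ (p─q , _)) (inj₁ (q∣p′ , _)) =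
    ⊥-elim (new (cong₂ _,_ (trans q∣p′ (cong proj₁ same)) (sym p─q)))

  turn-retreats : ∀ {p q p′} → cell p′ ≡ cell p → Turn p q p′ →
                  Prec (c (gc p)) p p′ × Prec (r (rowOf p)) (val p) (val p′)
  turn-retreats same (column-turn _ p≺q q≺p′) =
    let p≺p′ = Prec-trans _ p≺q q≺p′ in p≺p′ , oriented refl same p≺p′
  turn-retreats same (row-turn _ p≺q q≺p′) =
    let p≺p′ = Prec-trans _ p≺q q≺p′ in oriented⁻¹ refl same p≺p′ , p≺p′

Parallel : ∀ {m n} → Cell m n → Cell m n → Cell m n → Cell m n → Set
Parallel e e′ f f′ = (SameColumn e e′ × SameColumn f f′) ⊎ (SameRow e e′ × SameRow f f′)

module _ {m n} (P : PMM m n) {N} {π : Permutation′ N} (h g : Gridding (PMM.M P) π) where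
  private
    module H = Oriented P h
    module G = Oriented P g

  -- q lies between p and p′ in position (column turn) or in value (row turn), so g keeps it in
  -- their g-column (g-row); in their g-cell it would lie between them in both coordinates and
  -- hence in their h-cell.
  turn-regridded : ∀ {p q p′} → H.cell p′ ≡ H.cell p → H.cell q ≢ H.cell p → H.Turn p q p′ →
    G.cell p′ ≡ G.cell p → G.cell q ≢ G.cell p × Parallel (H.cell p) (H.cell q) (G.cell p) (G.cell q)
  turn-regridded {p} {q} {p′} h-same h-new (H.column-turn q∣p p≺q q≺p′) g-same =
    g-new , inj₁ (sym q∣p , sym g-column)
    where
    positions : Between p q p′
    positions = Prec⇒Between _ p≺q q≺p′
    g-column : Gridding.gc g q ≡ Gridding.gc g p
    g-column = monotone-Between (Gridding.gc g) (Gridding.gc-mono g) positions (cong proj₁ (sym g-same))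
    g-new : G.cell q ≢ G.cell p
    g-new q∈p = h-new (cong₂ _,_ q∣p (monotone-Between (Gridding.gr h) (Gridding.gr-mono h)
      (G.Between-in-cell refl q∈p g-same positions) (cong proj₂ (sym h-same))))
  turn-regridded {p} {q} {p′} h-same h-new (H.row-turn q─p p≺q q≺p′) g-same =
    g-new , inj₂ (sym q─p , sym g-row)
    where
    values : Between (H.val p) (H.val q) (H.val p′)
    values = Prec⇒Between _ p≺q q≺p′
    g-row : G.rowOf q ≡ G.rowOf p
    g-row = monotone-Between (Gridding.gr g) (Gridding.gr-mono g) values (cong proj₂ (sym g-same))
    g-new : G.cell q ≢ G.cell p
    g-new q∈p = h-new (cong₂ _,_ (monotone-Between (Gridding.gc h) (Gridding.gc-mono h)
      (G.Between-in-cell⁻¹ refl q∈p g-same values) (cong proj₁ (sym h-same))) q─p)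

-- Coils

Code : ℕ → ℕ → ℕ → Set
Code ℓ m n = Fin ℓ ⊎ Fin (suc ℓ) ⊎ (Fin (suc ℓ) × Fin ℓ × (Fin m ⊎ Fin n))

misplacedBound : ℕ → ℕ → ℕ → ℕ
misplacedBound ℓ m n = ℓ + (suc ℓ + suc ℓ * (ℓ * (m + n)))

Code↔Fin : ∀ {ℓ m n} → Code ℓ m n ↔ Fin (misplacedBound ℓ m n)
Code↔Fin = ↔-sym (↔-trans +↔⊎ (↔-refl ⊎-↔ (↔-trans +↔⊎ (↔-refl ⊎-↔
             (↔-trans *↔× (↔-refl ×-↔ (↔-trans *↔× (↔-refl ×-↔ +↔⊎))))))))

module Coil {m n} (P : PMM m n) (U : Unicyclic (PMM.M P)) {N} {π : Permutation′ N}
            {h : Gridding (PMM.M P) π} (coil : GriddedCoil P U π h) where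
  open PMM P using (M; c; r)
  open GriddedCoil coil
  private
    module H = Oriented P h
    C : Cycle M
    C = theCycle U
    ℓ : ℕ
    ℓ = len C
    instance
      N-nonZero : NonZero N
      N-nonZero = >-nonZero (≤-<-trans z≤n many)

  2<ℓ : 2 < ℓ
  2<ℓ = ≤-trans (n≤1+n 3) (*-monoʳ-≤ 2 (s≤s (s≤s z≤n)))

  1<ℓ : 1 < ℓ
  1<ℓ = <-trans (n<1+n 1) 2<ℓ

  -- Indices u ≥ N wrap around; the coil conditions are only used at indices below N.
  v : ℕ → Fin N
  v u = ord ⟨$⟩ʳ (u mod N)

  label : ℕ → Cell m n
  label u = lab (u mod ℓ)

  toℕ-mod : ∀ {u} → u < N → toℕ (u mod N) ≡ u
  toℕ-mod u<N = trans (toℕ-fromℕ< _) (m<n⇒m%n≡m u<N)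

  cell-v : ∀ {u} → u < N → H.cell (v u) ≡ label u
  cell-v {u} u<N = trans (C1 (u mod N)) (cong (λ i → lab (i mod ℓ)) (toℕ-mod u<N))

  arc-forward : ∀ {u} → suc u < N → Arc P h (v u) (v (suc u))
  arc-forward {u} u+1<N = C2 (u mod N) (suc u mod N)
    (trans (toℕ-mod u+1<N) (cong suc (sym (toℕ-mod (<-trans (n<1+n u) u+1<N)))))

  arc-back : ∀ {u} → suc (u + ℓ) < N → Arc P h (v (suc (u + ℓ))) (v u)
  arc-back {u} bound = subst (λ w → Arc P h (v w) (v u)) (+-suc u ℓ)
    (C3 (u mod N) ((u + suc ℓ) mod N)
      (trans (toℕ-mod bound′) (cong (_+ suc ℓ) (sym (toℕ-mod (≤-<-trans (m≤m+n u (suc ℓ)) bound′))))))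
    where
    bound′ : u + suc ℓ < N
    bound′ = subst (_< N) (sym (+-suc u ℓ)) bound

  label-mod : ∀ {u u′} → u % ℓ ≡ u′ % ℓ → label u ≡ label u′
  label-mod eq = cong lab (Finₚ.fromℕ<-cong _ _ eq _ _)

  label-periodic : ∀ u → label (u + ℓ) ≡ label u
  label-periodic u = label-mod {u + ℓ} {u} ([m+n]%n≡m%n u ℓ)

  label-periodic-* : ∀ u q → label (u + q * ℓ) ≡ label u
  label-periodic-* u q = label-mod {u + q * ℓ} {u} ([m+kn]%n≡m%n u q ℓ)

  label-distinct : ∀ u {d} → 0 < d → d < ℓ → label (d + u) ≢ label u
  label-distinct u 0<d d<ℓ eq = [d+m]%n≢m%n u 0<d d<ℓ (Finₚ.fromℕ<-injective _ _ _ _ (lab-inj eq))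

  consecutive-labels-distinct : ∀ u →
    ¬ (label u ≡ label (1 + u) ⊎ label (1 + u) ≡ label (2 + u) ⊎ label u ≡ label (2 + u))
  consecutive-labels-distinct u (inj₁ eq)        = label-distinct u       z<s 1<ℓ (sym eq)
  consecutive-labels-distinct u (inj₂ (inj₁ eq)) = label-distinct (1 + u) z<s 1<ℓ (sym eq)
  consecutive-labels-distinct u (inj₂ (inj₂ eq)) = label-distinct u       z<s 2<ℓ (sym eq)

  no-three-labels-in-a-column : ∀ u →
    ¬ (SameColumn (label u) (label (1 + u)) × SameColumn (label (1 + u)) (label (2 + u)))
  no-three-labels-in-a-column u (same₀₁ , same₁₂) = consecutive-labels-distinct u
    (at-most-two-in-a-column C (lab-in _) (lab-in _) (lab-in _) same₀₁ same₁₂)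

  no-three-labels-in-a-row : ∀ u →
    ¬ (SameRow (label u) (label (1 + u)) × SameRow (label (1 + u)) (label (2 + u)))
  no-three-labels-in-a-row u (same₀₁ , same₁₂) = consecutive-labels-distinct u
    (at-most-two-in-a-row C (lab-in _) (lab-in _) (lab-in _) same₀₁ same₁₂)

  Bounded : ℕ → Set
  Bounded y = suc (y + ℓ) < N

  Bounded⇒+ℓ< : ∀ {y} → Bounded y → y + ℓ < N
  Bounded⇒+ℓ< = <-trans (n<1+n _)

  Bounded⇒< : ∀ {y} → Bounded y → y < N
  Bounded⇒< {y} b = ≤-<-trans (m≤m+n y ℓ) (Bounded⇒+ℓ< b)

  returns : ∀ {y} → Bounded y → H.cell (v y) ≡ H.cell (v (y + ℓ))
  returns {y} b = trans (cell-v (Bounded⇒< b)) (trans (sym (label-periodic y)) (sym (cell-v (Bounded⇒+ℓ< b))))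

  moves-on : ∀ {y} → Bounded y → H.cell (v (suc (y + ℓ))) ≢ H.cell (v (y + ℓ))
  moves-on {y} b eq =
    label-distinct (y + ℓ) z<s 1<ℓ (trans (sym (cell-v b)) (trans eq (cell-v (Bounded⇒+ℓ< b))))

  turn-at : ∀ {y} → Bounded y → H.Turn (v (y + ℓ)) (v (suc (y + ℓ))) (v y)
  turn-at b = H.turn (returns b) (moves-on b) (arc-forward b) (arc-back b)

  Retreat : ℕ → Cell m n → Set
  Retreat y (i , j) = Prec (c i) (v (y + ℓ)) (v y) × Prec (r j) (H.val (v (y + ℓ))) (H.val (v y))

  retreats : ∀ {y} → Bounded y → Retreat y (label y)
  retreats {y} b = subst (Retreat y) (trans (cell-v (Bounded⇒+ℓ< b)) (label-periodic y))
    (H.turn-retreats (returns b) (turn-at b))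

  module Regridded (g : Gridding M π) where
    private
      module G = Oriented P g

    gcol : ℕ → Fin m
    gcol u = Gridding.gc g (v u)

    grow : ℕ → Fin n
    grow u = G.rowOf (v u)

    gcell : ℕ → Cell m n
    gcell u = G.cell (v u)

    column-descends : ∀ {y} → Bounded y → WeakPrec (c (proj₁ (label y))) (gcol (y + ℓ)) (gcol y)
    column-descends b = Prec⇒WeakPrec _ (Gridding.gc g) (Gridding.gc-mono g) (proj₁ (retreats b))

    row-descends : ∀ {y} → Bounded y → WeakPrec (r (proj₂ (label y))) (grow (y + ℓ)) (grow y)
    row-descends b = Prec⇒WeakPrec _ (Gridding.gr g) (Gridding.gr-mono g) (proj₂ (retreats b))

    Descent : ∀ {k} → (ℕ → Fin k) → ℕ → Fin k → Set
    Descent φ u a = Bounded u × φ (u + ℓ) ≢ φ u × φ (u + ℓ) ≡ a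

    -- Writing u = ρ + q ℓ, the values φ (ρ + q ℓ) descend in the single order σ (label ρ).
    descent-unique : ∀ {k} (φ : ℕ → Fin k) (σ : Cell m n → Sign) →
      (∀ {y} → Bounded y → WeakPrec (σ (label y)) (φ (y + ℓ)) (φ y)) →
      ∀ {u₁ u₂ a} → u₁ % ℓ ≡ u₂ % ℓ → Descent φ u₁ a → Descent φ u₂ a → u₁ ≡ u₂
    descent-unique {k} φ σ descends {u₁} {u₂} {a} residues d₁ d₂ = begin
      u₁                   ≡⟨ split u₁ refl ⟩
      ρ + u₁ / ℓ * ℓ       ≡⟨ cong (λ q → ρ + q * ℓ) q₁≡q₂ ⟩
      ρ + u₂ / ℓ * ℓ       ≡⟨ split u₂ (sym residues) ⟨
      u₂                   ∎
      where
      open ≡-Reasoning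
      ρ : ℕ
      ρ = u₁ % ℓ
      split : ∀ u → u % ℓ ≡ ρ → u ≡ ρ + u / ℓ * ℓ
      split u eq = trans (m≡m%n+[m/n]*n u ℓ) (cong (_+ u / ℓ * ℓ) eq)
      ψ : ℕ → Fin k
      ψ q = φ (ρ + q * ℓ)
      next-lap : ∀ q → ρ + suc q * ℓ ≡ ρ + q * ℓ + ℓ
      next-lap q = trans (cong (ρ +_) (+-comm ℓ (q * ℓ))) (sym (+-assoc ρ (q * ℓ) ℓ))
      Ok : ℕ → Set
      Ok q = Bounded (ρ + q * ℓ)
      Ok-down : ∀ {p q} → p ≤ q → Ok q → Ok p
      Ok-down p≤q = ≤-<-trans (s≤s (+-monoˡ-≤ ℓ (+-monoʳ-≤ ρ (*-monoˡ-≤ ℓ p≤q))))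
      descending : ∀ q → Ok q → WeakPrec (σ (label ρ)) (ψ (suc q)) (ψ q)
      descending q b = subst₂ (λ s x → WeakPrec s x (ψ q))
        (cong σ (label-periodic-* ρ q)) (cong φ (sym (next-lap q))) (descends b)
      lap-descent : ∀ u → u % ℓ ≡ ρ → Descent φ u a →
                    Ok (u / ℓ) × ψ (suc (u / ℓ)) ≢ ψ (u / ℓ) × ψ (suc (u / ℓ)) ≡ a
      lap-descent u eq d with subst (λ x → Descent φ x a) (split u eq) d
      ... | b , strict , lands rewrite next-lap (u / ℓ) = b , strict , lands
      q₁≡q₂ : u₁ / ℓ ≡ u₂ / ℓ
      q₁≡q₂ with lap-descent u₁ refl d₁ | lap-descent u₂ (sym residues) d₂
      ... | ok₁ , strict₁ , lands₁ | ok₂ , strict₂ , lands₂ =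
        strict-descents-injective (WeakPrec-isPartialOrder (σ (label ρ))) ψ Ok Ok-down descending
          ok₁ ok₂ strict₁ strict₂ (trans lands₁ (sym lands₂))

    Event : ℕ → Fin m ⊎ Fin n → Set
    Event u (inj₁ i) = Descent gcol u i
    Event u (inj₂ j) = Descent grow u j

    event-unique : ∀ {u₁ u₂} w → u₁ % ℓ ≡ u₂ % ℓ → Event u₁ w → Event u₂ w → u₁ ≡ u₂
    event-unique (inj₁ _) = descent-unique gcol (c ∘ proj₁) column-descends
    event-unique (inj₂ _) = descent-unique grow (r ∘ proj₂) row-descends

    event : ∀ {u} → Bounded u → gcell u ≢ gcell (u + ℓ) → ∃ (Event u)
    event {u} b differ with gcol (u + ℓ) Finₚ.≟ gcol u
    ... | no  new-column  = inj₁ _ , b , new-column , refl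
    ... | yes same-column = inj₂ _ , b , (λ same-row → differ (sym (cong₂ _,_ same-column same-row))) , refl

    module Window (s₀ : ℕ) (fits : ℓ + s₀ + ℓ < N)
                  (stable : ∀ r → r ≤ ℓ → gcell (r + s₀) ≡ gcell (r + s₀ + ℓ)) where

      -- E r and L r are the g-cell and the h-cell of v (r + s₀ + ℓ); F is E made ℓ-periodic.
      E : ℕ → Cell m n
      E r = gcell (r + s₀ + ℓ)

      L : ℕ → Cell m n
      L r = label (r + s₀)

      bounded : ∀ {r} → r < ℓ → Bounded (r + s₀)
      bounded r<ℓ = ≤-<-trans (+-monoˡ-≤ ℓ (+-monoˡ-≤ s₀ r<ℓ)) fits

      step : ∀ {r} → r < ℓ → E (suc r) ≢ E r × Parallel (L r) (L (suc r)) (E r) (E (suc r))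
      step {r} r<ℓ = map₂ (subst₂ (λ e e′ → Parallel e e′ (E r) (E (suc r)))
          (trans (cell-v (Bounded⇒+ℓ< b)) (label-periodic (r + s₀)))
          (trans (cell-v b) (label-periodic (suc (r + s₀)))))
        (turn-regridded P h g (returns b) (moves-on b) (turn-at b) (stable r (<⇒≤ r<ℓ)))
        where
        b : Bounded (r + s₀)
        b = bounded r<ℓ

      closes : E ℓ ≡ E 0
      closes = trans (sym (stable ℓ ≤-refl)) (cong gcell (+-comm ℓ s₀))

      F : ℕ → Cell m n
      F u = E (u % ℓ)

      F-suc : ∀ u → F (suc u) ≡ E (suc (u % ℓ))
      F-suc u with suc (u % ℓ) <? ℓ
      ... | yes inside = cong E (trans (sym ([1+m%n]%n≡[1+m]%n {ℓ} u)) (m<n⇒m%n≡m inside))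
      ... | no  wraps  = begin
        E (suc u % ℓ)              ≡⟨ cong E ([1+m%n]%n≡[1+m]%n {ℓ} u) ⟨
        E (suc (u % ℓ) % ℓ)        ≡⟨ cong (λ x → E (x % ℓ)) full ⟩
        E (ℓ % ℓ)                  ≡⟨ cong E (n%n≡0 ℓ) ⟩
        E 0                        ≡⟨ closes ⟨
        E ℓ                        ≡⟨ cong E full ⟨
        E (suc (u % ℓ))            ∎
        where
        open ≡-Reasoning
        full : suc (u % ℓ) ≡ ℓ
        full = ≤-antisym (m%n<n u ℓ) (≮⇒≥ wraps)

      L-mod : ∀ {u u′} → u % ℓ ≡ u′ % ℓ → L u ≡ L u′
      L-mod {u} {u′} eq = label-mod {u + s₀} {u′ + s₀} (%-cong-+ʳ {ℓ} {u} {u′} s₀ eq)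

      F-step : ∀ u → F (suc u) ≢ F u × Parallel (L u) (L (suc u)) (F u) (F (suc u))
      F-step u with step (m%n<n u ℓ)
      ... | new , parallel = new ∘ trans (sym (F-suc u)) ,
        subst₂ (λ e e′ → Parallel e e′ (F u) (F (suc u)))
          (L-mod {u % ℓ} {u} (m%n%n≡m%n u ℓ)) (L-mod {suc (u % ℓ)} {suc u} ([1+m%n]%n≡[1+m]%n {ℓ} u))
          (subst (Parallel _ _ (F u)) (sym (F-suc u)) parallel)

      row-then-column : ∀ u → SameRow (F u) (F (suc u)) → SameColumn (F (suc u)) (F (2 + u))
      row-then-column u same-row with F-step u | F-step (suc u)
      ... | new , inj₁ (_ , same-column) | _ = ⊥-elim (new (sym (cong₂ _,_ same-column same-row)))
      ... | _ , inj₂ (L-row , _) | _ , inj₁ (_ , next) = next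
      ... | _ , inj₂ (L-row , _) | _ , inj₂ (L-row′ , _) =
        ⊥-elim (no-three-labels-in-a-row (u + s₀) (L-row , L-row′))

      column-then-row : ∀ u → SameColumn (F u) (F (suc u)) → SameRow (F (suc u)) (F (2 + u))
      column-then-row u same-column with F-step u | F-step (suc u)
      ... | new , inj₂ (_ , same-row) | _ = ⊥-elim (new (sym (cong₂ _,_ same-column same-row)))
      ... | _ , inj₁ (L-col , _) | _ , inj₂ (_ , next) = next
      ... | _ , inj₁ (L-col , _) | _ , inj₁ (L-col′ , _) =
        ⊥-elim (no-three-labels-in-a-column (u + s₀) (L-col , L-col′))

      F-periodic : ∀ u → F (ℓ + u) ≡ F u
      F-periodic u = cong E (trans (cong (_% ℓ) (+-comm ℓ u)) ([m+n]%n≡m%n u ℓ))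

      F-nonzero : ∀ u → Nonzero M (F u)
      F-nonzero u = Gridding.nonempty-ok g (v (u % ℓ + s₀ + ℓ))

      F-distinct : ∀ u → F u ≢ F (suc u)
      F-distinct u eq = proj₁ (F-step u) (sym eq)

      start-in-cycle : InCycle C (E 0)
      start-in-cycle with F-step 0
      ... | _ , inj₂ (_ , same-row) =
        CellWalk.cells-in-cycle U F F-periodic F-nonzero F-distinct row-then-column column-then-row same-row 0
      ... | _ , inj₁ (_ , same-column) = subst (InCycle C) (cong E (n%n≡0 ℓ))
        (CellWalk.cells-in-cycle U (F ∘ suc) (λ u → trans (cong F (sym (+-suc ℓ u))) (F-periodic (suc u)))
          (F-nonzero ∘ suc) (F-distinct ∘ suc) (row-then-column ∘ suc) (column-then-row ∘ suc)
          (column-then-row 0 same-column) (ℓ ∸ 1))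

    -- The point v s is encoded by s if s < ℓ, by its distance from the end if it is among the
    -- last ℓ + 1 points, and otherwise by an event u = j + (s ∸ ℓ) with j ≤ ℓ, recorded by j,
    -- the residue of u and the g-column or g-row that v u moves to.
    Encodes : ℕ → Code ℓ m n → Set
    Encodes s (inj₁ i)                  = toℕ i ≡ s
    Encodes s (inj₂ (inj₁ i))           = toℕ i + suc s ≡ N
    Encodes s (inj₂ (inj₂ (j , ρ , w))) =
      ℓ ≤ s × toℕ ρ ≡ (toℕ j + (s ∸ ℓ)) % ℓ × Event (toℕ j + (s ∸ ℓ)) w

    Encodes-injective : ∀ {s₁ s₂} x → Encodes s₁ x → Encodes s₂ x → s₁ ≡ s₂
    Encodes-injective (inj₁ i)        e₁ e₂ = trans (sym e₁) e₂
    Encodes-injective (inj₂ (inj₁ i)) e₁ e₂ =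
      suc-injective (+-cancelˡ-≡ (toℕ i) _ _ (trans e₁ (sym e₂)))
    Encodes-injective (inj₂ (inj₂ (j , ρ , w))) (ℓ≤s₁ , ρ₁ , ev₁) (ℓ≤s₂ , ρ₂ , ev₂) =
      ∸-cancelʳ-≡ ℓ≤s₁ ℓ≤s₂ (+-cancelˡ-≡ (toℕ j) _ _ (event-unique w (trans (sym ρ₁) ρ₂) ev₁ ev₂))

    Stable : ℕ → Fin (suc ℓ) → Set
    Stable s₀ j = gcell (toℕ j + s₀) ≡ gcell (toℕ j + s₀ + ℓ)

    stable? : ∀ s₀ → Decidable (Stable s₀)
    stable? s₀ j = ≡-dec Finₚ._≟_ Finₚ._≟_ _ _

    stable-window⇒InCycle : ∀ {s} → ℓ ≤ s → Bounded s → (∀ j → Stable (s ∸ ℓ) j) →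
                            InCycle C (gcell s)
    stable-window⇒InCycle {s} ℓ≤s bounded stable =
      subst (InCycle C ∘ gcell) (m∸n+n≡m ℓ≤s) (Window.start-in-cycle (s ∸ ℓ) fits stable′)
      where
      fits : ℓ + (s ∸ ℓ) + ℓ < N
      fits = subst (λ x → x + ℓ < N) (sym (m+[n∸m]≡n ℓ≤s)) (Bounded⇒+ℓ< bounded)
      stable′ : ∀ r → r ≤ ℓ → gcell (r + (s ∸ ℓ)) ≡ gcell (r + (s ∸ ℓ) + ℓ)
      stable′ r r≤ℓ = subst (λ x → gcell (x + (s ∸ ℓ)) ≡ gcell (x + (s ∸ ℓ) + ℓ))
                        (toℕ-fromℕ< (s≤s r≤ℓ)) (stable (fromℕ< (s≤s r≤ℓ)))

    encode-event : ∀ {s} → ℓ ≤ s → Bounded s → ¬ InCycle C (gcell s) →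
                   ∃ λ x → Encodes s (inj₂ (inj₂ x))
    encode-event {s} ℓ≤s bounded misplaced with all? (stable? (s ∸ ℓ))
    ... | yes stable   = ⊥-elim (misplaced (stable-window⇒InCycle ℓ≤s bounded stable))
    ... | no  unstable with Finₚ.¬∀⟶∃¬ (suc ℓ) _ (stable? (s ∸ ℓ)) unstable
    ...   | j , differ = (j , u mod ℓ , proj₁ ev) , ℓ≤s , toℕ-fromℕ< _ , proj₂ ev
      where
      u : ℕ
      u = toℕ j + (s ∸ ℓ)
      u≤s : u ≤ s
      u≤s = subst (u ≤_) (m+[n∸m]≡n ℓ≤s) (+-monoˡ-≤ (s ∸ ℓ) (s≤s⁻¹ (toℕ<n j)))
      ev : ∃ (Event u)
      ev = event (≤-<-trans (s≤s (+-monoˡ-≤ ℓ u≤s)) bounded) differ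

    encode : ∀ s → s < N → ¬ InCycle C (gcell s) → ∃ (Encodes s)
    encode s s<N misplaced with s <? ℓ | suc (s + ℓ) <? N
    ... | yes s<ℓ | _           = inj₁ (fromℕ< s<ℓ) , toℕ-fromℕ< s<ℓ
    ... | no  s≮ℓ | yes bounded = map (inj₂ ∘ inj₂) id (encode-event (≮⇒≥ s≮ℓ) bounded misplaced)
    ... | no  _   | no near-end =
      inj₂ (inj₁ (fromℕ< tail<)) , trans (cong (_+ suc s) (toℕ-fromℕ< tail<)) (m∸n+n≡m s<N)
      where
      tail< : N ∸ suc s < suc ℓ
      tail< = s≤s (subst (N ∸ suc s ≤_) (m+n∸m≡n (suc s) ℓ) (∸-monoˡ-≤ (suc s) (≮⇒≥ near-end)))

    misplaced-count : ∀ {K} (f : Fin K → Fin N) → Injective _≡_ _≡_ f →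
                      (∀ k → Misplaced U g (f k)) → K ≤ misplacedBound ℓ m n
    misplaced-count {K} f f-inj misplaced = injective⇒≤ {f = Inverse.to Code↔Fin ∘ code} code-injective
      where
      position : Fin N → ℕ
      position x = toℕ (ord ⟨$⟩ˡ x)
      v-position : ∀ x → v (position x) ≡ x
      v-position x = trans (cong (ord ⟨$⟩ʳ_) (toℕ-injective (toℕ-mod (toℕ<n _)))) (inverseʳ ord)
      encoded : ∀ k → ∃ (Encodes (position (f k)))
      encoded k = encode (position (f k)) (toℕ<n _)
        (misplaced k ∘ subst (InCycle C ∘ cellOf g) (v-position (f k)))
      code : Fin K → Code ℓ m n
      code k = proj₁ (encoded k)
      code-injective : Injective _≡_ _≡_ (Inverse.to Code↔Fin ∘ code)
      code-injective {k₁} {k₂} eq = f-inj (begin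
        f k₁                  ≡⟨ v-position (f k₁) ⟨
        v (position (f k₁))   ≡⟨ cong v (Encodes-injective (code k₂)
                                    (subst (Encodes _) same-code (proj₂ (encoded k₁))) (proj₂ (encoded k₂))) ⟩
        v (position (f k₂))   ≡⟨ v-position (f k₂) ⟩
        f k₂                  ∎)
        where
        open ≡-Reasoning
        same-code : code k₁ ≡ code k₂
        same-code = Injection.injective (↔⇒↣ Code↔Fin) eq

lemma5p6 : ∀ {m n} (P : PMM m n) (U : Unicyclic (PMM.M P)) →
    ∃ λ (B : ℕ) → ∀ {N} (π : Permutation′ N) → IsCoil P U π →
    (g : Gridding (PMM.M P) π) →
    ∀ (K : ℕ) (f : Fin K → Fin N) → Injective _≡_ _≡_ f →
    (∀ k → Misplaced U g (f k)) → K ≤ B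
lemma5p6 {m} {n} P U =
  misplacedBound (len (theCycle U)) m n ,
  λ π (h , coil) g K f f-inj misplaced → Coil.Regridded.misplaced-count P U coil g f f-inj misplaced
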